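{- Let $T$ be a tree of order at least $2$ and let $v$ be a leaf of $T$. Then there exists a $\gamma_{sp}(T)$-set $S$ of $T$ such that $v\in \overline{S}$.
   Context: For a graph $G$ and $S\subseteq V(G)$, $\overline{S}=V(G)\setminus S$, and $N(v)$ denotes the open neighborhood of $v$. A set $S\subseteq V(G)$ is a super dominating set if for every vertex $u\in\overline{S}$ there exists $v\in S$ with $N(v)\cap\overline{S}=\{u\}$. The super domination number $\gamma_{sp}(G)$ is the minimum cardinality of a super dominating set of $G$, and a $\gamma_{sp}(G)$-set is a super dominating set of cardinality $\gamma_{sp}(G)$. A leaf is a vertex of degree $1$. -}

module Defs where

open import Data.Nat using (ℕ; zero; suc; _+_; _≤_)
open import Data.Bool using (Bool; true; false; if_then_else_)
open import Data.Fin using (Fin)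
open import Data.Fin.Subset using (Subset; _∈_; _∉_; ∣_∣)
open import Data.List using (List; []; _∷_; _++_; [_]; map; allFin)
open import Data.Nat.ListAction using (sum)
open import Data.List.Relation.Unary.Unique.Propositional using (Unique)
open import Data.Product using (Σ; ∃; _×_; _,_)
open import Data.Unit using (⊤)
open import Relation.Binary.PropositionalEquality using (_≡_)
open import Relation.Nullary using (¬_)

record Graph (n : ℕ) : Set where
  field
    adj   : Fin n → Fin n → Bool
    sym   : ∀ u v → adj u v ≡ adj v u
    irrefl : ∀ u → adj u u ≡ false

open Graph public

Adj : ∀ {n} → Graph n → Fin n → Fin n → Set
Adj G u v = adj G u v ≡ true

Chain : ∀ {n} → Graph n → List (Fin n) → Set
Chain G []           = ⊤
Chain G (x ∷ [])     = ⊤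
Chain G (x ∷ y ∷ xs) = Adj G x y × Chain G (y ∷ xs)

Connected : ∀ {n} → Graph n → Set
Connected {n} G = ∀ (u v : Fin n) → ∃ λ (xs : List (Fin n)) → Chain G (u ∷ xs ++ [ v ])

HasCycle : ∀ {n} → Graph n → Set
HasCycle {n} G =
  Σ (Fin n) λ x → Σ (Fin n) λ y → Σ (Fin n) λ z → Σ (List (Fin n)) λ xs →
    Unique (x ∷ y ∷ z ∷ xs) × Chain G (x ∷ y ∷ z ∷ xs ++ [ x ])

IsTree : ∀ {n} → Graph n → Set
IsTree G = Connected G × ¬ HasCycle G

degree : ∀ {n} → Graph n → Fin n → ℕ
degree {n} G v = sum (map (λ w → if adj G v w then 1 else 0) (allFin n))

IsLeaf : ∀ {n} → Graph n → Fin n → Set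
IsLeaf G v = degree G v ≡ 1

IsSuperDominating : ∀ {n} → Graph n → Subset n → Set
IsSuperDominating {n} G S =
  ∀ (u : Fin n) → u ∉ S →
    Σ (Fin n) λ v → v ∈ S × Adj G v u ×
      (∀ (w : Fin n) → w ∉ S → Adj G v w → w ≡ u)

IsGammaSpSet : ∀ {n} → Graph n → Subset n → Set
IsGammaSpSet {n} G S =
  IsSuperDominating G S × (∀ (S′ : Subset n) → IsSuperDominating G S′ → ∣ S ∣ ≤ ∣ S′ ∣)

-- Take a minimum super dominating set S together with a witness map w, sending each
-- vertex x outside S to a vertex w x ∈ S whose only neighbour outside S is x. If the
-- leaf v lies in S, let u be its neighbour; one of three exchanges moves v out of S
-- without enlarging it. If u ∉ S, redirect the witness of u to v and trade the witnesses
-- of all outside vertices for those vertices themselves. If u = w x, add x and drop v.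
-- Otherwise perform the same trade only inside the branches of T − u whose root lies
-- outside S; afterwards u has no neighbour outside the set, so v can be dropped.
module Submission where

open import Defs hiding (sym)
open import Data.Bool using (Bool; true; false; not; _∨_; if_then_else_)
open import Data.Bool.Properties using (not-¬; ¬-not; not-injective) renaming (_≟_ to _≟ᵇ_)
open import Data.Empty using (⊥-elim)
open import Data.Fin using (Fin; zero; suc; _≟_)
open import Data.Fin.Properties using (any?; all?; suc-injective; 0≢1+n)
open import Data.Fin.Subset using (Subset; _∈_; _∉_; ∣_∣; ⊤)
open import Data.Fin.Subset.Properties using (_∈?_; ∈⊤; anySubset?)
open import Data.List using (List; []; _∷_; _++_; [_])
import Data.List as List
open import Data.List.Relation.Unary.All using (All; []; _∷_)
open import Data.List.Relation.Unary.All.Properties.Core using (¬Any⇒All¬)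
open import Data.List.Relation.Unary.Any using (Any; here; there)
import Data.List.Relation.Unary.Any as Any
open import Data.List.Relation.Unary.AllPairs using ([]; _∷_)
open import Data.List.Relation.Unary.Unique.Propositional using (Unique)
open import Data.Nat using (ℕ; zero; suc; _+_; _≤_; _<_; z≤n; s≤s; _<?_)
open import Data.Nat.Induction using (<-wellFounded)
open import Data.Nat.ListAction using (sum)
open import Data.Nat.Properties
  using (≤-refl; ≤-trans; ≤-reflexive; n≤1+n; +-suc; +-monoʳ-≤; +-cancelʳ-≤; ≮⇒≥)
  renaming (suc-injective to suc-injectiveℕ)
open import Data.Product using (Σ; _×_; _,_; proj₁; proj₂)
open import Data.Sum using (_⊎_; inj₁; inj₂)
open import Data.Unit using (tt)
open import Data.Vec using (lookup; tabulate)
open import Data.Vec.Properties using (lookup∘tabulate; tabulate∘lookup; []=⇒lookup; lookup⇒[]=)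
open import Function using (_∘_)
open import Induction.WellFounded using (Acc; acc)
open import Relation.Binary.PropositionalEquality
  using (_≡_; _≢_; refl; sym; trans; cong; subst; subst₂; module ≡-Reasoning)
open import Relation.Nullary using (¬_; Dec; yes; no; does)
open import Relation.Nullary.Decidable using (_×-dec_; _→-dec_; ¬?; dec-true)
open import Relation.Unary using (Decidable)

adj-sym : ∀ {n} (G : Graph n) {x y} → Adj G x y → Adj G y x
adj-sym G {x} {y} x~y = trans (Graph.sym G y x) x~y

adj⇒≢ : ∀ {n} (G : Graph n) {x y} → Adj G x y → x ≢ y
adj⇒≢ G {x} x~x refl with trans (sym (irrefl G x)) x~x
... | ()

infixl 6 _[_≔_]
_[_≔_] : ∀ {a} {A : Set a} {n} → (Fin n → A) → Fin n → A → Fin n → A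
(f [ i ≔ y ]) x = if does (x ≟ i) then y else f x

[≔]-updates : ∀ {a} {A : Set a} {n} (f : Fin n → A) i {y : A} → (f [ i ≔ y ]) i ≡ y
[≔]-updates f i {y} = cong (λ b → if b then y else f i) (dec-true (i ≟ i) refl)

erase-false : ∀ {n} (s : Fin n → Bool) t {x} → (s [ t ≔ false ]) x ≡ false → x ≡ t ⊎ s x ≡ false
erase-false s t {x} sx with x ≟ t
... | yes x≡t = inj₁ x≡t
... | no  _   = inj₂ sx

erase-true : ∀ {n} (s : Fin n → Bool) t {x} → x ≢ t → s x ≡ true → (s [ t ≔ false ]) x ≡ true
erase-true s t {x} x≢t sx with x ≟ t
... | yes x≡t = ⊥-elim (x≢t x≡t)
... | no  _   = sx

insert-true : ∀ {n} (s : Fin n → Bool) t {x} → s x ≡ true → (s [ t ≔ true ]) x ≡ true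
insert-true s t {x} sx with x ≟ t
... | yes _ = refl
... | no  _ = sx

insert-false : ∀ {n} (s : Fin n → Bool) t {x} → (s [ t ≔ true ]) x ≡ false → x ≢ t × s x ≡ false
insert-false s t {x} sx with x ≟ t
insert-false s t {x} () | yes _
insert-false s t {x} sx | no x≢t = x≢t , sx

indicator : Bool → ℕ
indicator b = if b then 1 else 0

count : ∀ {n} → (Fin n → Bool) → ℕ
count {zero}  s = 0
count {suc n} s = indicator (s zero) + count (s ∘ suc)

count-complement : ∀ {n} (s : Fin n → Bool) → count s + count (not ∘ s) ≡ n
count-complement {zero}  s = refl
count-complement {suc n} s with s zero
... | true  = cong suc (count-complement (s ∘ suc))
... | false = trans (+-suc (count (s ∘ suc)) _) (cong suc (count-complement (s ∘ suc)))

count-erase : ∀ {n} (s : Fin n → Bool) t → s t ≡ true → count s ≡ suc (count (s [ t ≔ false ]))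
count-erase {suc n} s zero    st rewrite st = refl
count-erase {suc n} s (suc t) st =
  trans (cong (indicator (s zero) +_) (count-erase (s ∘ suc) t st)) (+-suc (indicator (s zero)) _)

count-insert : ∀ {n} (s : Fin n → Bool) t → s t ≡ false → count (s [ t ≔ true ]) ≡ suc (count s)
count-insert {suc n} s zero    st rewrite st = refl
count-insert {suc n} s (suc t) st =
  trans (cong (indicator (s zero) +_) (count-insert (s ∘ suc) t st)) (+-suc (indicator (s zero)) _)

count-injection : ∀ {m k} (s : Fin m → Bool) (t : Fin k → Bool) (φ : Fin m → Fin k) →
  (∀ x → s x ≡ true → t (φ x) ≡ true) →
  (∀ x y → s x ≡ true → s y ≡ true → φ x ≡ φ y → x ≡ y) →
  count s ≤ count t
count-injection {zero}  s t φ into inj = z≤n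
count-injection {suc m} s t φ into inj with s zero in s0
... | false =
  count-injection (s ∘ suc) t (φ ∘ suc) (into ∘ suc) (λ x y sx sy → suc-injective ∘ inj (suc x) (suc y) sx sy)
... | true =
  ≤-trans (s≤s (count-injection (s ∘ suc) (t [ φ zero ≔ false ]) (φ ∘ suc) into′
                  (λ x y sx sy → suc-injective ∘ inj (suc x) (suc y) sx sy)))
          (≤-reflexive (sym (count-erase t (φ zero) (into zero s0))))
  where
  into′ : ∀ x → s (suc x) ≡ true → (t [ φ zero ≔ false ]) (φ (suc x)) ≡ true
  into′ x sx with φ (suc x) ≟ φ zero
  ... | yes clash = ⊥-elim (0≢1+n (sym (inj (suc x) zero sx s0 clash)))
  ... | no  _     = into (suc x) sx

count-≤-complement-injection : ∀ {n} (s s′ : Fin n → Bool) (φ : Fin n → Fin n) →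
  (∀ x → s x ≡ false → s′ (φ x) ≡ false) →
  (∀ x y → s x ≡ false → s y ≡ false → φ x ≡ φ y → x ≡ y) →
  count s′ ≤ count s
count-≤-complement-injection s s′ φ into inj =
  +-cancelʳ-≤ (count (not ∘ s′)) (count s′) (count s)
    (subst (_≤ count s + count (not ∘ s′)) (trans (count-complement s) (sym (count-complement s′)))
      (+-monoʳ-≤ (count s) complements))
  where
  not≡true : ∀ {b} → not b ≡ true → b ≡ false
  not≡true = not-injective
  complements : count (not ∘ s) ≤ count (not ∘ s′)
  complements = count-injection (not ∘ s) (not ∘ s′) φ
    (λ x sx → cong not (into x (not≡true sx)))
    (λ x y sx sy → inj x y (not≡true sx) (not≡true sy))

count≡0 : ∀ {n} (s : Fin n → Bool) → count s ≡ 0 → ∀ x → s x ≡ false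
count≡0 {suc n} s c x with s zero in s0
count≡0 {suc n} s () x       | true
count≡0 {suc n} s c zero     | false = s0
count≡0 {suc n} s c (suc x)  | false = count≡0 (s ∘ suc) c x

count≡1 : ∀ {n} (s : Fin n → Bool) → count s ≡ 1 →
  Σ (Fin n) λ u → s u ≡ true × (∀ x → s x ≡ true → x ≡ u)
count≡1 {suc n} s c with s zero in s0
... | true = zero , s0 , only
  where
  only : ∀ x → s x ≡ true → x ≡ zero
  only zero    _  = refl
  only (suc x) sx = ⊥-elim (not-¬ sx (count≡0 (s ∘ suc) (suc-injectiveℕ c) x))
... | false with count≡1 (s ∘ suc) c
...   | u , su , only′ = suc u , su , only
  where
  only : ∀ x → s x ≡ true → x ≡ suc u
  only zero    sx = ⊥-elim (not-¬ sx s0)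
  only (suc x) sx = cong suc (only′ x sx)

sum-indicator≡count : ∀ {m k} (e : Fin m → Fin k) (s : Fin k → Bool) →
  sum (List.map (λ x → if s x then 1 else 0) (List.tabulate e)) ≡ count (s ∘ e)
sum-indicator≡count {zero}  e s = refl
sum-indicator≡count {suc m} e s = cong (indicator (s (e zero)) +_) (sum-indicator≡count (e ∘ suc) s)

leaf⇒uniqueNeighbour : ∀ {n} (G : Graph n) v → IsLeaf G v →
  Σ (Fin n) λ u → Adj G v u × (∀ x → Adj G v x → x ≡ u)
leaf⇒uniqueNeighbour G v leaf =
  count≡1 (adj G v) (trans (sym (sum-indicator≡count (λ x → x) (adj G v))) leaf)

∣tabulate∣≡count : ∀ {n} (s : Fin n → Bool) → ∣ tabulate s ∣ ≡ count s
∣tabulate∣≡count {zero}  s = refl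
∣tabulate∣≡count {suc n} s with s zero
... | true  = cong suc (∣tabulate∣≡count (s ∘ suc))
... | false = ∣tabulate∣≡count (s ∘ suc)

∣∣≡count∘lookup : ∀ {n} (S : Subset n) → ∣ S ∣ ≡ count (lookup S)
∣∣≡count∘lookup S =
  subst (λ S′ → ∣ S′ ∣ ≡ count (lookup S)) (tabulate∘lookup S) (∣tabulate∣≡count (lookup S))

lookup-∉ : ∀ {n} {S : Subset n} {x} → x ∉ S → lookup S x ≡ false
lookup-∉ {S = S} {x} x∉S = ¬-not (λ Sx → x∉S (lookup⇒[]= x S Sx))

lookup-false⇒∉ : ∀ {n} {S : Subset n} {x} → lookup S x ≡ false → x ∉ S
lookup-false⇒∉ Sx x∈S = not-¬ ([]=⇒lookup x∈S) Sx

-- Vertex sets are handled as characteristic functions Fin n → Bool; tabulate and lookup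
-- translate them to and from Subset n.
IsSuperDominatingᵇ : ∀ {n} → Graph n → (Fin n → Bool) → Set
IsSuperDominatingᵇ {n} G s = ∀ x → s x ≡ false →
  Σ (Fin n) λ y → s y ≡ true × Adj G y x × (∀ z → s z ≡ false → Adj G y z → z ≡ x)

lookup-superDominating : ∀ {n} {G : Graph n} {S} →
  IsSuperDominating G S → IsSuperDominatingᵇ G (lookup S)
lookup-superDominating sd x Sx with sd x (lookup-false⇒∉ Sx)
... | y , y∈S , y~x , only = y , []=⇒lookup y∈S , y~x , λ z Sz → only z (lookup-false⇒∉ Sz)

tabulate-∉ : ∀ {n} {s : Fin n → Bool} {x} → x ∉ tabulate s → s x ≡ false
tabulate-∉ {s = s} {x} x∉ = trans (sym (lookup∘tabulate s x)) (lookup-∉ x∉)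

tabulate-∈ : ∀ {n} {s : Fin n → Bool} {x} → s x ≡ true → x ∈ tabulate s
tabulate-∈ {s = s} {x} sx = lookup⇒[]= x (tabulate s) (trans (lookup∘tabulate s x) sx)

tabulate-superDominating : ∀ {n} {G : Graph n} {s} →
  IsSuperDominatingᵇ G s → IsSuperDominating G (tabulate s)
tabulate-superDominating sd x x∉ with sd x (tabulate-∉ x∉)
... | y , sy , y~x , only = y , tabulate-∈ sy , y~x , λ z z∉ → only z (tabulate-∉ z∉)

-- w x is only constrained for x outside s.
record Witnesses {n} (G : Graph n) (s : Fin n → Bool) : Set where
  field
    w         : Fin n → Fin n
    w-member  : ∀ x → s x ≡ false → s (w x) ≡ true
    w-adj     : ∀ x → s x ≡ false → Adj G (w x) x
    w-private : ∀ x → s x ≡ false → ∀ y → s y ≡ false → Adj G (w x) y → y ≡ x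

  w-injective : ∀ x y → s x ≡ false → s y ≡ false → w x ≡ w y → x ≡ y
  w-injective x y sx sy wx≡wy = w-private y sy x sx (subst (λ z → Adj G z x) wx≡wy (w-adj x sx))

  superDominating : IsSuperDominatingᵇ G s
  superDominating x sx = w x , w-member x sx , w-adj x sx , w-private x sx

witnesses : ∀ {n} {G : Graph n} {s} → IsSuperDominatingᵇ G s → Witnesses G s
witnesses {n} {G} {s} sd = record
  { w         = λ x → proj₁ (pick x)
  ; w-member  = λ x sx → proj₁ (proj₂ (pick x) sx)
  ; w-adj     = λ x sx → proj₁ (proj₂ (proj₂ (pick x) sx))
  ; w-private = λ x sx → proj₂ (proj₂ (proj₂ (pick x) sx))
  }
  where
  Dominates : Fin n → Fin n → Set
  Dominates y x = s y ≡ true × Adj G y x × (∀ z → s z ≡ false → Adj G y z → z ≡ x)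
  pick′ : ∀ x b → s x ≡ b → Σ (Fin n) λ y → b ≡ false → Dominates y x
  pick′ x true  _  = x , λ ()
  pick′ x false sx = proj₁ (sd x sx) , λ _ → proj₂ (sd x sx)
  pick : ∀ x → Σ (Fin n) λ y → s x ≡ false → Dominates y x
  pick x = pick′ x (s x) refl

SmallerAvoiding : ∀ {n} → Graph n → Fin n → (Fin n → Bool) → Set
SmallerAvoiding {n} G v s =
  Σ (Fin n → Bool) λ s′ → IsSuperDominatingᵇ G s′ × s′ v ≡ false × count s′ ≤ count s

∨≡false : ∀ a b → a ∨ b ≡ false → a ≡ false × b ≡ false
∨≡false false false _ = refl , refl

-- The flagged vertices outside s enter the set and their witnesses leave it.
module Flip {n} {G : Graph n} {s : Fin n → Bool} (W : Witnesses G s) (F : Fin n → Bool) where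
  open Witnesses W

  WitnessOfFlagged : Fin n → Set
  WitnessOfFlagged x = Σ (Fin n) λ a → s a ≡ false × F a ≡ true × w a ≡ x

  witnessOfFlagged? : ∀ x → Dec (WitnessOfFlagged x)
  witnessOfFlagged? x = any? λ a → (s a ≟ᵇ false) ×-dec (F a ≟ᵇ true) ×-dec (w a ≟ x)

  flipped : Fin n → Bool
  flipped x = if does (witnessOfFlagged? x) then false else s x ∨ F x

  flipped-false : ∀ x → flipped x ≡ false → (s x ≡ false × F x ≡ false) ⊎ WitnessOfFlagged x
  flipped-false x fx with witnessOfFlagged? x
  ... | yes image = inj₂ image
  ... | no  _     = inj₁ (∨≡false (s x) (F x) fx)

  flipped-unflagged : ∀ x → s x ≡ false → F x ≡ false → flipped x ≡ false
  flipped-unflagged x sx Fx with does (witnessOfFlagged? x)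
  ... | true  = refl
  ... | false rewrite sx | Fx = refl

  flipped-witness : ∀ a → s a ≡ false → F a ≡ true → flipped (w a) ≡ false
  flipped-witness a sa Fa =
    cong (λ b → if b then false else s (w a) ∨ F (w a))
         (dec-true (witnessOfFlagged? (w a)) (a , sa , Fa , refl))

  Apart : (Fin n → Fin n → Set) → Set
  Apart R = ∀ a y → s a ≡ false → F a ≡ true → s y ≡ false → F y ≡ false → ¬ R a y

  flipped-superDominating :
    Apart (Adj G) → Apart (λ a y → Adj G (w y) (w a)) → IsSuperDominatingᵇ G flipped
  flipped-superDominating apart witnesses-apart x fx with flipped-false x fx
  ... | inj₁ (sx , Fx) = w x , ¬-not wx-stays , w-adj x sx , only
    where
    wx-stays : flipped (w x) ≢ false
    wx-stays fwx with flipped-false (w x) fwx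
    ... | inj₁ (swx , _) = not-¬ (w-member x sx) swx
    ... | inj₂ (a , sa , Fa , wa≡wx) with w-injective a x sa sx wa≡wx
    ...   | refl = not-¬ Fa Fx
    only : ∀ z → flipped z ≡ false → Adj G (w x) z → z ≡ x
    only z fz wx~z with flipped-false z fz
    ... | inj₁ (sz , _) = w-private x sx z sz wx~z
    ... | inj₂ (a , sa , Fa , refl) = ⊥-elim (witnesses-apart a x sa Fa sx Fx wx~z)
  flipped-superDominating apart witnesses-apart _ fx | inj₂ (a , sa , Fa , refl) =
    a , ¬-not a-enters , adj-sym G (w-adj a sa) , only
    where
    a-enters : flipped a ≢ false
    a-enters fa with flipped-false a fa
    ... | inj₁ (_ , Fa′) = not-¬ Fa Fa′
    ... | inj₂ (b , sb , _ , refl) = not-¬ (w-member b sb) sa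
    only : ∀ z → flipped z ≡ false → Adj G a z → z ≡ w a
    only z fz a~z with flipped-false z fz
    ... | inj₁ (sz , Fz) = ⊥-elim (apart a z sa Fa sz Fz a~z)
    ... | inj₂ (b , sb , _ , refl) = cong w (sym (w-private b sb a sa (adj-sym G a~z)))

  flipped-count : count flipped ≤ count s
  flipped-count = count-≤-complement-injection s flipped φ into inj
    where
    φ : Fin n → Fin n
    φ x = if F x then w x else x
    into : ∀ x → s x ≡ false → flipped (φ x) ≡ false
    into x sx with F x in Fx
    ... | true  = flipped-witness x sx Fx
    ... | false = flipped-unflagged x sx Fx
    inj : ∀ x y → s x ≡ false → s y ≡ false → φ x ≡ φ y → x ≡ y
    inj x y sx sy φx≡φy with F x | F y
    ... | true  | true  = w-injective x y sx sy φx≡φy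
    ... | false | false = φx≡φy
    ... | true  | false = ⊥-elim (not-¬ (w-member x sx) (subst (λ z → s z ≡ false) (sym φx≡φy) sy))
    ... | false | true  = ⊥-elim (not-¬ (w-member y sy) (subst (λ z → s z ≡ false) φx≡φy sx))

insert-superDominating : ∀ {n} {G : Graph n} {s} t →
  IsSuperDominatingᵇ G s → IsSuperDominatingᵇ G (s [ t ≔ true ])
insert-superDominating {s = s} t sd x sx with sd x (proj₂ (insert-false s t sx))
... | y , sy , y~x , only = y , insert-true s t sy , y~x , λ z sz → only z (proj₂ (insert-false s t sz))

module Leaf {n} {G : Graph n} {v u : Fin n} (v~u : Adj G v u) (leaf : ∀ x → Adj G v x → x ≡ u) where

  -- Flagging every vertex turns s into the complement of w(s̄), which misses v = w u.
  redirectWitness : ∀ {s} → Witnesses G s → s v ≡ true → s u ≡ false → SmallerAvoiding G v s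
  redirectWitness {s} W sv su =
    flipped , flipped-superDominating (λ _ _ _ _ _ ()) (λ _ _ _ _ _ ()) , v-leaves , flipped-count
    where
    open Witnesses W
    member : ∀ x → s x ≡ false → s ((w [ u ≔ v ]) x) ≡ true
    member x sx with x ≟ u
    ... | yes _ = sv
    ... | no  _ = w-member x sx
    adjacent : ∀ x → s x ≡ false → Adj G ((w [ u ≔ v ]) x) x
    adjacent x sx with x ≟ u
    ... | yes refl = v~u
    ... | no  _    = w-adj x sx
    only : ∀ x → s x ≡ false → ∀ y → s y ≡ false → Adj G ((w [ u ≔ v ]) x) y → y ≡ x
    only x sx y sy wx~y with x ≟ u
    ... | yes refl = leaf y wx~y
    ... | no  _    = w-private x sx y sy wx~y
    redirected : Witnesses G s
    redirected = record { w = w [ u ≔ v ] ; w-member = member ; w-adj = adjacent ; w-private = only }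
    open Flip redirected (λ _ → true)
    v-leaves : flipped v ≡ false
    v-leaves = subst (λ z → flipped z ≡ false) ([≔]-updates w u) (flipped-witness u su refl)

  dropLeaf-superDominating : ∀ {s} → Witnesses G s → s v ≡ true → s u ≡ true →
    (∀ p → s p ≡ false → ¬ Adj G u p) → IsSuperDominatingᵇ G (s [ v ≔ false ])
  dropLeaf-superDominating {s} W sv su u-isolated x sx′ with erase-false s v sx′
  ... | inj₁ refl = u , erase-true s v (adj⇒≢ G (adj-sym G v~u)) su , adj-sym G v~u , only
    where
    only : ∀ z → (s [ v ≔ false ]) z ≡ false → Adj G u z → z ≡ v
    only z sz′ u~z with erase-false s v sz′
    ... | inj₁ z≡v = z≡v
    ... | inj₂ sz  = ⊥-elim (u-isolated z sz u~z)
  ... | inj₂ sx = w x , erase-true s v wx≢v (w-member x sx) , w-adj x sx , only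
    where
    open Witnesses W
    wx≢v : w x ≢ v
    wx≢v wx≡v = not-¬ su (subst (λ z → s z ≡ false) x≡u sx)
      where
      x≡u : x ≡ u
      x≡u = leaf x (subst (λ z → Adj G z x) wx≡v (w-adj x sx))
    only : ∀ z → (s [ v ≔ false ]) z ≡ false → Adj G (w x) z → z ≡ x
    only z sz′ wx~z with erase-false s v sz′
    ... | inj₁ refl =
      ⊥-elim (u-isolated x sx (subst (λ y → Adj G y x) (leaf (w x) (adj-sym G wx~z)) (w-adj x sx)))
    ... | inj₂ sz   = w-private x sx z sz wx~z

  swapLeaf : ∀ {s} (W : Witnesses G s) → s v ≡ true → s u ≡ true →
    ∀ x → s x ≡ false → Witnesses.w W x ≡ u → SmallerAvoiding G v s
  swapLeaf {s} W sv su x sx wx≡u =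
    s₁ [ v ≔ false ] ,
    dropLeaf-superDominating (witnesses (insert-superDominating {G = G} x superDominating))
      (insert-true s x sv) (insert-true s x su) u-isolated ,
    [≔]-updates s₁ v ,
    ≤-reflexive (suc-injectiveℕ (trans (sym (count-erase s₁ v (insert-true s x sv))) (count-insert s x sx)))
    where
    open Witnesses W
    s₁ : Fin n → Bool
    s₁ = s [ x ≔ true ]
    u-isolated : ∀ p → s₁ p ≡ false → ¬ Adj G u p
    u-isolated p s₁p u~p with insert-false s x s₁p
    ... | p≢x , sp = p≢x (w-private x sx p sp (subst (λ z → Adj G z p) (sym wx≡u) u~p))

module Branches {n} {T : Graph n} (tree : IsTree T) (u : Fin n) where

  data Walk : Fin n → Fin n → Set where
    stay : ∀ {p} → p ≢ u → Walk p p
    step : ∀ {p q r} → p ≢ u → Adj T p q → Walk q r → Walk p r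

  start≢u : ∀ {p q} → Walk p q → p ≢ u
  start≢u (stay p≢u)     = p≢u
  start≢u (step p≢u _ _) = p≢u

  later : ∀ {p q} → Walk p q → List (Fin n)
  later (stay _)               = []
  later (step {q = q} _ _ ws) = q ∷ later ws

  vertices : ∀ {p q} → Walk p q → List (Fin n)
  vertices {p} ws = p ∷ later ws

  _++ʷ_ : ∀ {p q r} → Walk p q → Walk q r → Walk p r
  stay _         ++ʷ ws′ = ws′
  step p≢u e ws  ++ʷ ws′ = step p≢u e (ws ++ʷ ws′)

  reverse : ∀ {p q} → Walk p q → Walk q p
  reverse (stay p≢u)       = stay p≢u
  reverse (step p≢u e ws) = reverse ws ++ʷ step (start≢u ws) (adj-sym T e) (stay p≢u)

  avoids : ∀ {p q} (ws : Walk p q) → All (u ≢_) (vertices ws)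
  avoids (stay p≢u)       = (p≢u ∘ sym) ∷ []
  avoids (step p≢u _ ws) = (p≢u ∘ sym) ∷ avoids ws

  chain : ∀ {p q c} (ws : Walk p q) → Adj T q c → Chain T (vertices ws ++ [ c ])
  chain (stay _)       q~c = q~c , tt
  chain (step _ e ws) q~c = e , chain ws q~c

  suffixFrom : ∀ {p q x} (ws : Walk p q) → Unique (vertices ws) → Any (x ≡_) (vertices ws) →
    Σ (Walk x q) (Unique ∘ vertices)
  suffixFrom ws             uq        (here refl) = ws , uq
  suffixFrom (step _ _ ws) (_ ∷ uq) (there x∈)  = suffixFrom ws uq x∈
  suffixFrom (stay _)       _         (there ())

  shortcut : ∀ {p q} → Walk p q → Σ (Walk p q) (Unique ∘ vertices)
  shortcut (stay p≢u) = stay p≢u , [] ∷ []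
  shortcut (step {p} p≢u e ws) with shortcut ws
  ... | ws′ , uq with Any.any? (p ≟_) (vertices ws′)
  ...   | yes p∈ = suffixFrom ws′ uq p∈
  ...   | no  p∉ = step p≢u e ws′ , ¬Any⇒All¬ _ p∉ ∷ uq

  -- A nontrivial walk would close a cycle through u.
  neighbours-unlinked : ∀ {p q} → Adj T u p → Adj T q u → Walk p q → p ≡ q
  neighbours-unlinked u~p q~u ws with shortcut ws
  ... | stay _ , _ = refl
  ... | step {q = r} p≢u e ws′ , uq =
    ⊥-elim (proj₂ tree (u , _ , r , later ws′ ,
                        avoids (step p≢u e ws′) ∷ uq , u~p , chain (step p≢u e ws′) q~u))

  exit : ∀ y xs → y ≢ u → Chain T (y ∷ xs ++ [ u ]) → Σ (Fin n) λ r → Walk y r × Adj T r u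
  exit y []       y≢u (y~u , _) = y , stay y≢u , y~u
  exit y (z ∷ zs) y≢u (y~z , ch) with z ≟ u
  ... | yes refl = y , stay y≢u , y~z
  ... | no  z≢u with exit z zs z≢u ch
  ...   | r , ws , r~u = r , step y≢u y~z ws , r~u

  exitFrom : ∀ y → y ≢ u → Σ (Fin n) λ r → Walk y r × Adj T r u
  exitFrom y y≢u = exit y (proj₁ (proj₁ tree y u)) y≢u (proj₂ (proj₁ tree y u))

  -- For y ≢ u, the root of y is the neighbour of u in the component of T − u containing y.
  root : Fin n → Fin n
  root y with y ≟ u
  ... | yes _   = y
  ... | no  y≢u = proj₁ (exitFrom y y≢u)

  root-spec : ∀ {y} → y ≢ u → Walk y (root y) × Adj T (root y) u
  root-spec {y} y≢u with y ≟ u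
  ... | yes y≡u  = ⊥-elim (y≢u y≡u)
  ... | no  y≢u′ = proj₂ (exitFrom y y≢u′)

  root-adj : ∀ {x y} → x ≢ u → y ≢ u → Adj T x y → root x ≡ root y
  root-adj x≢u y≢u x~y with root-spec x≢u | root-spec y≢u
  ... | x⇝rx , rx~u | y⇝ry , ry~u =
    neighbours-unlinked (adj-sym T rx~u) ry~u (reverse x⇝rx ++ʷ step x≢u x~y y⇝ry)

  root-neighbour : ∀ {p} → Adj T u p → root p ≡ p
  root-neighbour {p} u~p with root-spec (adj⇒≢ T u~p ∘ sym)
  ... | p⇝rp , rp~u = sym (neighbours-unlinked u~p rp~u p⇝rp)

module LeafOfTree {n} {T : Graph n} (tree : IsTree T) {v u : Fin n}
  (v~u : Adj T v u) (leaf : ∀ x → Adj T v x → x ≡ u) where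
  open Leaf {G = T} v~u leaf
  open Branches tree u

  flipBranches : ∀ {s} (W : Witnesses T s) → s v ≡ true → s u ≡ true →
    (∀ x → s x ≡ false → Witnesses.w W x ≢ u) → SmallerAvoiding T v s
  flipBranches {s} W sv su u-unused =
    flipped [ v ≔ false ] ,
    dropLeaf-superDominating (witnesses flipped-sd) fv fu u-isolated ,
    [≔]-updates flipped v ,
    ≤-trans (≤-trans (n≤1+n _) (≤-reflexive (sym (count-erase flipped v fv)))) flipped-count
    where
    open Witnesses W
    rootOutside : Fin n → Bool
    rootOutside = not ∘ s ∘ root
    open Flip W rootOutside
    ≢u : ∀ {x} → s x ≡ false → x ≢ u
    ≢u sx refl = not-¬ su sx
    root-w : ∀ x → s x ≡ false → root x ≡ root (w x)
    root-w x sx = root-adj (≢u sx) (u-unused x sx) (adj-sym T (w-adj x sx))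
    rootOutside-neighbour : ∀ {p} → Adj T u p → rootOutside p ≡ not (s p)
    rootOutside-neighbour u~p = cong (not ∘ s) (root-neighbour u~p)
    different-roots : ∀ a y → rootOutside a ≡ true → rootOutside y ≡ false → root a ≢ root y
    different-roots a y Fa Fy ra≡ry = not-¬ Fa (trans (cong (not ∘ s) ra≡ry) Fy)
    flipped-sd : IsSuperDominatingᵇ T flipped
    flipped-sd = flipped-superDominating
      (λ a y sa Fa sy Fy a~y → different-roots a y Fa Fy (root-adj (≢u sa) (≢u sy) a~y))
      (λ a y sa Fa sy Fy wy~wa → different-roots a y Fa Fy (begin
        root a     ≡⟨ root-w a sa ⟩
        root (w a) ≡⟨ sym (root-adj (u-unused y sy) (u-unused a sa) wy~wa) ⟩
        root (w y) ≡⟨ sym (root-w y sy) ⟩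
        root y     ∎))
      where open ≡-Reasoning
    fu : flipped u ≡ true
    fu = ¬-not u-stays
      where
      u-stays : flipped u ≢ false
      u-stays fu′ with flipped-false u fu′
      ... | inj₁ (su′ , _)           = not-¬ su su′
      ... | inj₂ (a , sa , _ , wa≡u) = u-unused a sa wa≡u
    fv : flipped v ≡ true
    fv = ¬-not v-stays
      where
      v-stays : flipped v ≢ false
      v-stays fv′ with flipped-false v fv′
      ... | inj₁ (sv′ , _)           = not-¬ sv sv′
      ... | inj₂ (a , sa , _ , refl) = ≢u sa (leaf a (w-adj a sa))
    u-isolated : ∀ p → flipped p ≡ false → ¬ Adj T u p
    u-isolated p fp u~p with flipped-false p fp
    ... | inj₁ (sp , Fp) = not-¬ (cong not sp) (trans (sym (rootOutside-neighbour u~p)) Fp)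
    ... | inj₂ (a , sa , Fa , refl) = not-¬ (w-member a sa) (not-injective (begin
      not (s (w a))     ≡⟨ sym (rootOutside-neighbour u~p) ⟩
      rootOutside (w a) ≡⟨ cong (not ∘ s) (sym (root-w a sa)) ⟩
      rootOutside a     ≡⟨ Fa ⟩
      true              ∎))
      where open ≡-Reasoning

  exchange : ∀ {s} → IsSuperDominatingᵇ T s → SmallerAvoiding T v s
  exchange {s} sd with s v in sv
  ... | false = s , sd , sv , ≤-refl
  ... | true with s u in su
  ...   | false = redirectWitness (witnesses sd) sv su
  ...   | true with any? (λ x → (s x ≟ᵇ false) ×-dec (Witnesses.w (witnesses sd) x ≟ u))
  ...     | yes (x , sx , wx≡u) = swapLeaf (witnesses sd) sv su x sx wx≡u
  ...     | no  u-unused        =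
    flipBranches (witnesses sd) sv su (λ x sx wx≡u → u-unused (x , sx , wx≡u))

minimum : ∀ {n} {P : Subset n → Set} → Decidable P → ∀ S → P S →
  Σ (Subset n) λ M → P M × (∀ S′ → P S′ → ∣ M ∣ ≤ ∣ S′ ∣)
minimum {n} {P} P? S pS = descend S pS (<-wellFounded ∣ S ∣)
  where
  descend : ∀ S → P S → Acc _<_ ∣ S ∣ →
    Σ (Subset n) λ M → P M × (∀ S′ → P S′ → ∣ M ∣ ≤ ∣ S′ ∣)
  descend S pS (acc smaller) with anySubset? (λ S′ → P? S′ ×-dec (∣ S′ ∣ <? ∣ S ∣))
  ... | yes (S′ , pS′ , S′<S) = descend S′ pS′ (smaller S′<S)
  ... | no  none              = S , pS , λ S′ pS′ → ≮⇒≥ (λ S′<S → none (S′ , pS′ , S′<S))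

superDominating? : ∀ {n} (G : Graph n) → Decidable (IsSuperDominating G)
superDominating? G S =
  all? λ x → ¬? (x ∈? S) →-dec
    any? λ y → (y ∈? S) ×-dec (adj G y x ≟ᵇ true) ×-dec
      all? λ z → ¬? (z ∈? S) →-dec (adj G y z ≟ᵇ true) →-dec (z ≟ x)

gammaSpSet : ∀ {n} (G : Graph n) → Σ (Subset n) (IsGammaSpSet G)
gammaSpSet G = minimum (superDominating? G) ⊤ (λ _ x∉⊤ → ⊥-elim (x∉⊤ ∈⊤))

proposition2p4 : (n : ℕ) → 2 ≤ n → (T : Graph n) → IsTree T →
    (v : Fin n) → IsLeaf T v →
    Σ (Subset n) λ S → IsGammaSpSet T S × v ∉ S
-- The bound 2 ≤ n is implied by the existence of a leaf.
proposition2p4 n _ T tree v v-leaf with leaf⇒uniqueNeighbour T v v-leaf | gammaSpSet T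
... | u , v~u , leaf | S₀ , sd₀ , S₀-minimum
  with LeafOfTree.exchange tree v~u leaf (lookup-superDominating {G = T} sd₀)
... | s , sd , sv , s≤S₀ =
  tabulate s ,
  (tabulate-superDominating {G = T} sd , λ S′ sd′ → ≤-trans size (S₀-minimum S′ sd′)) ,
  lookup-false⇒∉ v-out
  where
  size : ∣ tabulate s ∣ ≤ ∣ S₀ ∣
  size = subst₂ _≤_ (sym (∣tabulate∣≡count s)) (sym (∣∣≡count∘lookup S₀)) s≤S₀
  v-out : lookup (tabulate s) v ≡ false
  v-out = trans (lookup∘tabulate s v) sv
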